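{- For every connected block graph $G$, the subgraph of $G$ induced by any center set of $G$ is connected.
   Context: All graphs are finite and simple; $d$ is shortest-path distance. A block is a maximal induced subgraph without a cut-vertex; a block graph is a graph every block of which is complete. For nonempty $S\subseteq V(G)$, $e_S(v)=\max_{x\in S}d(v,x)$ and $C_S(G)=\{v\in V: e_S(v)\le e_S(x)\ \forall x\in V\}$. A set $A\subseteq V$ is a center set of $G$ if $A=C_S(G)$ for some nonempty $S\subseteq V$. -}

module Defs where

open import Data.Nat using (ℕ; zero; suc; _≤_; _⊔_)
open import Data.Bool using (Bool; true; false; _∧_; _∨_; if_then_else_; T)
open import Data.Fin using (Fin; _≟_)
import Data.Fin.Subset.Properties
open import Data.Fin.Subset using (Subset; _∈_; _∉_; _⊆_; Nonempty)
open import Data.List using (List; []; _∷_; foldr; allFin)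
open import Data.Bool.ListAction using (any)
open import Data.Product using (Σ; _×_; _,_)
open import Relation.Nullary using (¬_)
open import Relation.Nullary.Decidable using (⌊_⌋)
open import Relation.Binary.PropositionalEquality using (_≡_)

record Graph (n : ℕ) : Set where
  field
    adj     : Fin n → Fin n → Bool
    adj-sym : ∀ u v → adj u v ≡ adj v u
    adj-irr : ∀ v → adj v v ≡ false
open Graph public

module _ {n : ℕ} (G : Graph n) where

  Adj : Fin n → Fin n → Set
  Adj u v = T (adj G u v)

  data WalkIn (A : Subset n) : Fin n → Fin n → Set where
    here : ∀ {v} → v ∈ A → WalkIn A v v
    step : ∀ {u w v} → u ∈ A → Adj u w → WalkIn A w v → WalkIn A u v

  InducedConnected : Subset n → Set
  InducedConnected A = ∀ u v → u ∈ A → v ∈ A → WalkIn A u v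

  Connected : Set
  Connected = InducedConnected Data.Fin.Subset.⊤

  remove : Subset n → Fin n → Subset n
  remove A c = A Data.Fin.Subset.∩ Data.Fin.Subset.∁ Data.Fin.Subset.⁅ c ⁆

  NoCutVertex : Subset n → Set
  NoCutVertex B = Nonempty B × InducedConnected B
                × (∀ c → c ∈ B → InducedConnected (remove B c))

  IsBlock : Subset n → Set
  IsBlock B = NoCutVertex B × (∀ B′ → B ⊆ B′ → NoCutVertex B′ → B′ ⊆ B)

  Complete : Subset n → Set
  Complete B = ∀ u v → u ∈ B → v ∈ B → ¬ (u ≡ v) → Adj u v

  IsBlockGraph : Set
  IsBlockGraph = ∀ B → IsBlock B → Complete B

  reach : ℕ → Fin n → Fin n → Bool
  reach zero    u v = ⌊ u ≟ v ⌋
  reach (suc k) u v = reach k u v ∨ any (λ w → reach k u w ∧ adj G w v) (allFin n)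

  -- least k < fuel with p k = true, and fuel if there is none
  bmin : (ℕ → Bool) → ℕ → ℕ
  bmin p zero     = zero
  bmin p (suc f)  = if p zero then zero else suc (bmin (λ k → p (suc k)) f)

  -- d(u,v): the least k with a walk of length ≤ k from u to v.
  -- (Every distance in a connected graph on n vertices is < n; for
  -- disconnected pairs this returns n, which never matters below since
  -- G is assumed connected.)
  dist : Fin n → Fin n → ℕ
  dist u v = bmin (λ k → reach k u v) n

  ecc : Subset n → Fin n → ℕ
  ecc S v = foldr (λ x m → if ⌊ x Data.Fin.Subset.Properties.∈? S ⌋ then dist v x ⊔ m else m) 0 (allFin n)

  InCenter : Subset n → Fin n → Set
  InCenter S v = ∀ x → ecc S v ≤ ecc S x

  IsCenterSet : Subset n → Set
  IsCenterSet A = Σ (Subset n) λ S → Nonempty S × (∀ v → (v ∈ A → InCenter S v) × (InCenter S v → v ∈ A))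

-- Let u, v be centres of S at distance k + 2 and w the neighbour of v on a
-- shortest u–v path. In a block graph d(w,x) ≤ max (d(u,x), d(v,x)) for every
-- x: otherwise d(u,x) ≤ d(v,x) < d(w,x), so if y is the neighbour of w on a
-- shortest u–w path, shortest paths y ⇝ u ⇝ x ⇝ v all avoid w. Shortcut to a
-- path and closed up through w they form a cycle; a cycle lies in a block,
-- blocks are complete, so y ~ v and d(u,v) ≤ k + 1, a contradiction. Hence
-- e_S(w) ≤ max (e_S(u), e_S(v)), so w is again a centre, and induction on
-- d(u,v) joins u to v inside the centre.
module Submission where

open import Defs
open import Data.Bool using (Bool; true; false; T; if_then_else_)
open import Data.Bool.Properties using (T-∨; T-∧; T-≡)
open import Data.Empty using (⊥; ⊥-elim)
open import Data.Fin using (Fin; _≟_)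
import Data.Fin.Properties as Fin
open import Data.Fin.Subset using (Subset; _∈_; _⊆_; _⊂_; ∣_∣)
open import Data.Fin.Subset.Properties
  using (_∈?_; ∈⊤; ∣p∣≤n; p⊂q⇒∣p∣<∣q∣; x∈p∩q⁺; x∈p∩q⁻; x∉p⇒x∈∁p; x∈∁p⇒x∉p; x≢y⇒x∉⁅y⁆; x∉⁅y⁆⇒x≢y)
open import Data.List using (List; []; _∷_; _++_; [_]; length; lookup; allFin; foldr)
open import Data.List.Properties using (length-++)
open import Data.List.Membership.Propositional using (lose) renaming (_∈_ to _∈ₗ_; _∉_ to _∉ₗ_)
open import Data.List.Membership.Propositional.Properties using (∈-allFin; ∈-lookup; ∈-++⁻)
import Data.List.Membership.DecPropositional as DecMembership
open import Data.List.Relation.Binary.Subset.Propositional using () renaming (_⊆_ to _⊆ₗ_)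
open import Data.List.Relation.Unary.All as All using (All; []; _∷_)
open import Data.List.Relation.Unary.All.Properties using (¬Any⇒All¬)
open import Data.List.Relation.Unary.AllPairs using ([]; _∷_)
open import Data.List.Relation.Unary.Any using (here; there; satisfied)
open import Data.List.Relation.Unary.Any.Properties using (any⁺; any⁻)
open import Data.List.Relation.Unary.Unique.Propositional using (Unique)
open import Data.Nat using (ℕ; zero; suc; _≤_; _<_; _≤′_; ≤′-refl; ≤′-step; _⊔_; _+_; z≤n; s≤s; _≤?_; _<?_)
open import Data.Nat.Properties
  using ( ≤-refl; ≤-trans; ≤-antisym; ≤-reflexive; ≤-pred; ≤-<-trans; <⇒≱; ≰⇒>; ≮⇒≥; ≤⇒≤′; 1+n≰n
        ; m≤n⇒m≤1+n; m≤m+n; +-comm; +-monoʳ-≤; +-suc; m≤m⊔n; m≤n⊔m; ⊔-lub; ⊔-mono-≤; m≤n⇒m⊔n≡n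
        ; module ≤-Reasoning)
open import Data.Product using (Σ; ∃-syntax; _×_; _,_; proj₁; proj₂; uncurry)
open import Data.Sum using (_⊎_; inj₁; inj₂)
open import Data.Vec using (tabulate)
open import Data.Vec.Properties using (lookup∘tabulate; lookup⇒[]=; []=⇒lookup)
open import Function using (_∘_; Injective)
open import Function.Bundles using (Equivalence)
open import Relation.Nullary using (¬_; yes; no)
open import Relation.Nullary.Decidable using (⌊_⌋; fromWitness; toWitness; decidable-stable)
open import Relation.Nullary.Decidable.Core using (T?)
open import Relation.Binary.PropositionalEquality using (_≡_; _≢_; refl; sym; trans; subst; cong; ≢-sym)

module _ {a} {A : Set a} where

  Unique⇒lookup-injective : ∀ {xs : List A} → Unique xs → Injective _≡_ _≡_ (lookup xs)
  Unique⇒lookup-injective {_ ∷ _}  (_  ∷ _)    {Fin.zero}  {Fin.zero}  _  = refl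
  Unique⇒lookup-injective {_ ∷ xs} (x∉ ∷ _)    {Fin.zero}  {Fin.suc j} eq =
    ⊥-elim (All.lookup x∉ (∈-lookup {xs = xs} j) eq)
  Unique⇒lookup-injective {_ ∷ xs} (x∉ ∷ _)    {Fin.suc i} {Fin.zero}  eq =
    ⊥-elim (All.lookup x∉ (∈-lookup {xs = xs} i) (sym eq))
  Unique⇒lookup-injective {_ ∷ _}  (_  ∷ uniq) {Fin.suc i} {Fin.suc j} eq =
    cong Fin.suc (Unique⇒lookup-injective uniq eq)

  ∉-∷-++ : ∀ {z x y : A} {xs ys} → z ∉ₗ x ∷ xs → z ∉ₗ y ∷ ys → z ∉ₗ x ∷ xs ++ ys
  ∉-∷-++ z∉xs _ (here z≡x) = z∉xs (here z≡x)
  ∉-∷-++ {xs = xs} z∉xs z∉ys (there z∈) with ∈-++⁻ xs z∈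
  ... | inj₁ z∈xs = z∉xs (there z∈xs)
  ... | inj₂ z∈ys = z∉ys (there z∈ys)

Unique⇒length≤ : ∀ {n} {xs : List (Fin n)} → Unique xs → length xs ≤ n
Unique⇒length≤ {n} {xs} uniq with length xs ≤? n
... | yes ≤n = ≤n
... | no ≰n with Fin.pigeonhole (≰⇒> ≰n) (lookup xs)
...   | i , j , i<j , eq = ⊥-elim (Fin.<⇒≢ i<j (Unique⇒lookup-injective uniq eq))

module _ {n : ℕ} (G : Graph n) where

  open DecMembership (_≟_ {n}) using () renaming (_∈?_ to _∈ₗ?_)

  private
    variable
      j k : ℕ
      u v w x y z c : Fin n
      vs ws : List (Fin n)
      X : Subset n

  -- Reachability and distance

  -- A record rather than T (reach G k u v), so that k, u, v are inferable.
  record Reach (k : ℕ) (u v : Fin n) : Set where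
    constructor reached
    field reachable : T (reach G k u v)
  open Reach

  d : Fin n → Fin n → ℕ
  d = dist G

  Adj-sym : Adj G u v → Adj G v u
  Adj-sym {u} {v} = subst T (adj-sym G u v)

  bmin-≤ : ∀ f (p : ℕ → Bool) → T (p k) → k < f → bmin G p f ≤ k
  bmin-≤ (suc f) p pk k<f with p zero in eq
  ... | true = z≤n
  bmin-≤ {zero}  (suc f) p pk _          | false = ⊥-elim (subst T eq pk)
  bmin-≤ {suc k} (suc f) p pk (s≤s k<f) | false = s≤s (bmin-≤ f (p ∘ suc) pk k<f)

  bmin-witness : ∀ f (p : ℕ → Bool) → bmin G p f < f → T (p (bmin G p f))
  bmin-witness (suc f) p lt with p zero in eq
  ... | true  = Equivalence.from T-≡ eq
  ... | false = bmin-witness f (p ∘ suc) (≤-pred lt)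

  bmin-≤-fuel : ∀ f (p : ℕ → Bool) → bmin G p f ≤ f
  bmin-≤-fuel zero    p = z≤n
  bmin-≤-fuel (suc f) p with p zero
  ... | true  = z≤n
  ... | false = s≤s (bmin-≤-fuel f (p ∘ suc))

  reach-refl : ∀ v → Reach 0 v v
  reach-refl v = reached (fromWitness refl)

  reach-zero⇒≡ : Reach 0 u v → u ≡ v
  reach-zero⇒≡ = toWitness ∘ reachable

  reach-suc : Reach k u v → Reach (suc k) u v
  reach-suc r = reached (Equivalence.from T-∨ (inj₁ (reachable r)))

  reach-mono : j ≤ k → Reach j u v → Reach k u v
  reach-mono j≤k = go (≤⇒≤′ j≤k)
    where
    go : j ≤′ k → Reach j u v → Reach k u v
    go ≤′-refl     r = r
    go (≤′-step p) r = reach-suc (go p r)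

  reach-snoc : Reach k u w → Adj G w v → Reach (suc k) u v
  reach-snoc {w = w} r a =
    reached (Equivalence.from T-∨ (inj₂ (any⁺ _ (lose (∈-allFin w) (Equivalence.from T-∧ (reachable r , a))))))

  reach-last : Reach (suc k) u v → Reach k u v ⊎ ∃[ w ] Reach k u w × Adj G w v
  reach-last r with Equivalence.to T-∨ (reachable r)
  ... | inj₁ r′ = inj₁ (reached r′)
  ... | inj₂ r′ with satisfied (any⁻ _ (allFin n) r′)
  ...   | w , rw with Equivalence.to T-∧ rw
  ...     | r″ , a = inj₂ (w , reached r″ , a)

  reach-cons : Adj G v w → Reach k w u → Reach (suc k) v u
  reach-cons {k = zero} a r with reach-zero⇒≡ r
  ... | refl = reach-snoc (reach-refl _) a
  reach-cons {k = suc k} a r with reach-last r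
  ... | inj₁ r′             = reach-suc (reach-cons a r′)
  ... | inj₂ (_ , r′ , a′) = reach-snoc (reach-cons a r′) a′

  reach-sym : Reach k u v → Reach k v u
  reach-sym {zero} r with reach-zero⇒≡ r
  ... | refl = r
  reach-sym {suc k} r with reach-last r
  ... | inj₁ r′            = reach-suc (reach-sym r′)
  ... | inj₂ (_ , r′ , a) = reach-cons (Adj-sym a) (reach-sym r′)

  dist-≤ : Reach k u v → d u v ≤ k
  dist-≤ {k} {u} {v} r with k <? n
  ... | yes k<n = bmin-≤ n (λ j → reach G j u v) (reachable r) k<n
  ... | no  k≮n = ≤-trans (bmin-≤-fuel n _) (≮⇒≥ k≮n)

  dist<n⇒reach-dist : d u v < n → Reach (d u v) u v
  dist<n⇒reach-dist = reached ∘ bmin-witness n _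

  -- Walks and paths

  -- Walk u v vs: a walk from u to v, vs listing the vertices after u in order,
  -- so that its length is length vs and its vertices are u ∷ vs.
  infixr 5 _∷_
  data Walk : Fin n → Fin n → List (Fin n) → Set where
    []  : Walk v v []
    _∷_ : Adj G u w → Walk w v vs → Walk u v (w ∷ vs)

  walk-++ : Walk u v vs → Walk v w ws → Walk u w (vs ++ ws)
  walk-++ []      q = q
  walk-++ (a ∷ p) q = a ∷ walk-++ p q

  walk-end : Walk u v vs → v ∈ₗ u ∷ vs
  walk-end []      = here refl
  walk-end (_ ∷ p) = there (walk-end p)

  walk→reach : Walk u v vs → Reach (length vs) u v
  walk→reach []      = reach-refl _
  walk→reach (a ∷ p) = reach-cons a (walk→reach p)

  reach→walk : Reach k u v → ∃[ vs ] Walk u v vs × length vs ≤ k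
  reach→walk {zero} r with reach-zero⇒≡ r
  ... | refl = [] , [] , z≤n
  reach→walk {suc k} {v = v} r with reach-last r
  ... | inj₁ r′ with reach→walk r′
  ...   | vs , p , len = vs , p , m≤n⇒m≤1+n len
  reach→walk {suc k} {v = v} r | inj₂ (_ , r′ , a) with reach→walk r′
  ...   | vs , p , len = vs ++ [ v ] , walk-++ p (a ∷ []) ,
                         ≤-trans (≤-reflexive (trans (length-++ vs) (+-comm _ 1))) (s≤s len)

  walk-reach-from : Walk u v vs → y ∈ₗ u ∷ vs → Reach (length vs) u y
  walk-reach-from p       (here refl) = reach-mono z≤n (reach-refl _)
  walk-reach-from (a ∷ p) (there y∈)  = reach-cons a (walk-reach-from p y∈)

  walk-reach-to : Walk u v vs → y ∈ₗ u ∷ vs → Reach (length vs) y v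
  walk-reach-to p       (here refl) = walk→reach p
  walk-reach-to (_ ∷ p) (there y∈)  = reach-suc (walk-reach-to p y∈)

  ∉-walk-from : Walk u v vs → length vs < d u z → z ∉ₗ u ∷ vs
  ∉-walk-from p len z∈ = <⇒≱ len (dist-≤ (walk-reach-from p z∈))

  ∉-walk-to : Walk u v vs → length vs < d z v → z ∉ₗ u ∷ vs
  ∉-walk-to p len z∈ = <⇒≱ len (dist-≤ (walk-reach-to p z∈))

  walk-suffix : Walk u v vs → Unique (u ∷ vs) → y ∈ₗ u ∷ vs →
                ∃[ ys ] Walk y v ys × Unique (y ∷ ys) × ys ⊆ₗ vs
  walk-suffix p       uniq       (here refl) = _ , p , uniq , λ z∈ → z∈
  walk-suffix (_ ∷ p) (_ ∷ uniq) (there y∈) with walk-suffix p uniq y∈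
  ... | ys , q , uniq′ , ys⊆ = ys , q , uniq′ , λ z∈ → there (ys⊆ z∈)

  shortcut : Walk u v vs → ∃[ vs′ ] Walk u v vs′ × Unique (u ∷ vs′) × vs′ ⊆ₗ vs
  shortcut [] = [] , [] , [] ∷ [] , λ ()
  shortcut {u} (_∷_ {w = w} a p) with shortcut p
  ... | vs′ , p′ , uniq , vs′⊆ with u ∈ₗ? w ∷ vs′
  ...   | yes u∈ with walk-suffix p′ uniq u∈
  ...     | ys , q , uniq′ , ys⊆ = ys , q , uniq′ , λ z∈ → there (vs′⊆ (ys⊆ z∈))
  shortcut {u} (_∷_ {w = w} a p) | vs′ , p′ , uniq , vs′⊆ | no u∉ =
    w ∷ vs′ , a ∷ p′ , ¬Any⇒All¬ _ u∉ ∷ uniq ,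
    λ { (here refl) → here refl ; (there z∈) → there (vs′⊆ z∈) }

  walkIn-end : WalkIn G X u v → v ∈ X
  walkIn-end (here v∈)    = v∈
  walkIn-end (step _ _ p) = walkIn-end p

  walkIn-++ : WalkIn G X u v → WalkIn G X v w → WalkIn G X u w
  walkIn-++ (here _)      q = q
  walkIn-++ (step u∈ a p) q = step u∈ a (walkIn-++ p q)

  walkIn-snoc : WalkIn G X u v → Adj G v w → w ∈ X → WalkIn G X u w
  walkIn-snoc p a w∈ = walkIn-++ p (step (walkIn-end p) a (here w∈))

  walkIn-reverse : WalkIn G X u v → WalkIn G X v u
  walkIn-reverse (here u∈)     = here u∈
  walkIn-reverse (step u∈ a p) = walkIn-snoc (walkIn-reverse p) (Adj-sym a) u∈

  walkIn⇒walk : WalkIn G X u v → ∃[ vs ] Walk u v vs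
  walkIn⇒walk (here _) = [] , []
  walkIn⇒walk (step _ a p) with walkIn⇒walk p
  ... | vs , q = _ , a ∷ q

  walk⇒walkIn : Walk u v vs → All (_∈ X) (u ∷ vs) → y ∈ₗ u ∷ vs → WalkIn G X y v
  walk⇒walkIn []      (u∈ ∷ []) (here refl) = here u∈
  walk⇒walkIn (a ∷ p) (u∈ ∷ X∋) (here refl) = step u∈ a (walk⇒walkIn p X∋ (here refl))
  walk⇒walkIn (_ ∷ p) (_  ∷ X∋) (there y∈)  = walk⇒walkIn p X∋ y∈

  -- Cycles and blocks

  ∈-remove⁺ : y ∈ X → y ≢ c → y ∈ remove G X c
  ∈-remove⁺ y∈ y≢c = x∈p∩q⁺ (y∈ , x∉p⇒x∈∁p (x≢y⇒x∉⁅y⁆ y≢c))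

  ∈-remove⁻ : y ∈ remove G X c → y ∈ X × y ≢ c
  ∈-remove⁻ {X = X} y∈ with x∈p∩q⁻ X _ y∈
  ... | y∈X , y∈∁c = y∈X , x∉⁅y⁆⇒x≢y (x∈∁p⇒x∉p y∈∁c)

  -- Cutting a path at c: a vertex before c can still go back to the start,
  -- a vertex after c can go on to the end.
  walkIn-avoiding : Walk u v vs → Unique (u ∷ vs) → All (_∈ X) (u ∷ vs) → y ∈ₗ u ∷ vs → y ≢ c →
                    WalkIn G (remove G X c) y v ⊎ WalkIn G (remove G X c) y u
  walkIn-avoiding []      _ (u∈ ∷ _) (here refl) y≢c = inj₁ (here (∈-remove⁺ u∈ y≢c))
  walkIn-avoiding (_ ∷ _) _ (u∈ ∷ _) (here refl) y≢c = inj₂ (here (∈-remove⁺ u∈ y≢c))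
  walkIn-avoiding {u} {c = c} (a ∷ p) (u≢ ∷ uniq) (u∈ ∷ X∋) (there y∈) y≢c
    with walkIn-avoiding p uniq X∋ y∈ y≢c
  ... | inj₁ to-v = inj₁ to-v
  ... | inj₂ to-w with u ≟ c
  ...   | no  u≢c = inj₂ (walkIn-snoc to-w (Adj-sym a) (∈-remove⁺ u∈ u≢c))
  ...   | yes refl =
    inj₁ (walk⇒walkIn p (All.zipWith (uncurry ∈-remove⁺) (X∋ , All.map ≢-sym u≢)) y∈)

  vertexSet : List (Fin n) → Subset n
  vertexSet vs = tabulate (λ y → ⌊ y ∈ₗ? vs ⌋)

  ∈-vertexSet⁺ : y ∈ₗ vs → y ∈ vertexSet vs
  ∈-vertexSet⁺ {y} {vs} y∈ =
    lookup⇒[]= y _ (trans (lookup∘tabulate _ y) (Equivalence.to T-≡ (fromWitness y∈)))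

  ∈-vertexSet⁻ : y ∈ vertexSet vs → y ∈ₗ vs
  ∈-vertexSet⁻ {y} {vs} y∈ =
    toWitness (Equivalence.from T-≡ (trans (sym (lookup∘tabulate _ y)) ([]=⇒lookup y∈)))

  cycle-noCutVertex : Walk w v vs → Unique (w ∷ vs) → Adj G v w → NoCutVertex G (vertexSet (w ∷ vs))
  cycle-noCutVertex {w} {v} {vs} p uniq vw =
    (w , ∈-vertexSet⁺ (here refl)) , connected , connected-remove
    where
    C : Subset n
    C = vertexSet (w ∷ vs)

    C∋ : All (_∈ C) (w ∷ vs)
    C∋ = All.tabulate ∈-vertexSet⁺

    connected : InducedConnected G C
    connected y z y∈ z∈ = walkIn-++ (to-v y∈) (walkIn-reverse (to-v z∈))
      where
      to-v : ∀ {x} → x ∈ C → WalkIn G C x v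
      to-v x∈ = walk⇒walkIn p C∋ (∈-vertexSet⁻ x∈)

    connected-remove : ∀ c → c ∈ C → InducedConnected G (remove G C c)
    connected-remove c _ y z y∈ z∈ with v ≟ c
    ... | no v≢c = walkIn-++ (to-v y∈) (walkIn-reverse (to-v z∈))
      where
      to-v : ∀ {x} → x ∈ remove G C c → WalkIn G (remove G C c) x v
      to-v x∈ with ∈-remove⁻ x∈
      ... | x∈C , x≢c with walkIn-avoiding p uniq C∋ (∈-vertexSet⁻ x∈C) x≢c
      ...   | inj₁ to-v = to-v
      ...   | inj₂ to-w = walkIn-snoc to-w (Adj-sym vw) (∈-remove⁺ (∈-vertexSet⁺ (walk-end p)) v≢c)
    ... | yes refl = walkIn-++ (to-w y∈) (walkIn-reverse (to-w z∈))
      where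
      to-w : ∀ {x} → x ∈ remove G C c → WalkIn G (remove G C c) x w
      to-w x∈ with ∈-remove⁻ x∈
      ... | x∈C , x≢c with walkIn-avoiding p uniq C∋ (∈-vertexSet⁻ x∈C) x≢c
      ...   | inj₁ to-v = ⊥-elim (proj₂ (∈-remove⁻ (walkIn-end to-v)) refl)
      ...   | inj₂ to-w = to-w

  -- Only up to double negation: maximality quantifies over all supersets and
  -- is not decidable. The fuel f bounds how often C can still grow.
  noCutVertex⊆block : ∀ {C} → NoCutVertex G C → ¬ ¬ (Σ (Subset n) λ B → IsBlock G B × C ⊆ B)
  noCutVertex⊆block = grow n (m≤m+n n _)
    where
    BlockAbove : Subset n → Set
    BlockAbove C = Σ (Subset n) λ B → IsBlock G B × C ⊆ B

    grow  : ∀ f {C} → n ≤ f + ∣ C ∣ → NoCutVertex G C → ¬ ¬ BlockAbove C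
    grow⊂ : ∀ f {C B′} → n ≤ f + ∣ C ∣ → C ⊂ B′ → NoCutVertex G B′ → ¬ ¬ BlockAbove B′

    grow f {C} n≤ ncv ¬block = ¬block (C , (ncv , maximal) , λ x∈ → x∈)
      where
      maximal : ∀ B′ → C ⊆ B′ → NoCutVertex G B′ → B′ ⊆ C
      maximal B′ C⊆B′ ncv′ {x} x∈B′ = decidable-stable (x ∈? C) λ x∉C →
        grow⊂ f n≤ (C⊆B′ , x , x∈B′ , x∉C) ncv′
          λ { (B , block , B′⊆B) → ¬block (B , block , B′⊆B ∘ C⊆B′) }

    grow⊂ zero    {B′ = B′} n≤ C⊂B′ _ = ⊥-elim (<⇒≱ (p⊂q⇒∣p∣<∣q∣ C⊂B′) (≤-trans (∣p∣≤n B′) n≤))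
    grow⊂ (suc f) n≤ C⊂B′ =
      grow f (≤-trans n≤ (≤-trans (≤-reflexive (sym (+-suc f _))) (+-monoʳ-≤ f (p⊂q⇒∣p∣<∣q∣ C⊂B′))))

  blockGraph⇒noCutVertex-complete : IsBlockGraph G → ∀ {C} → NoCutVertex G C → Complete G C
  blockGraph⇒noCutVertex-complete blockGraph ncv u v u∈ v∈ u≢v =
    decidable-stable (T? (adj G u v)) λ ¬uv → noCutVertex⊆block ncv λ { (B , block , C⊆B) →
      ¬uv (blockGraph B block u v (C⊆B u∈) (C⊆B v∈) u≢v) }

  -- Eccentricity

  private
    eccOver : Subset n → Fin n → List (Fin n) → ℕ
    eccOver S v = foldr (λ x m → if ⌊ x ∈? S ⌋ then dist G v x ⊔ m else m) 0

  dist≤ecc : ∀ {S} → x ∈ S → d v x ≤ ecc G S v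
  dist≤ecc {x} {v} {S} x∈S = go (allFin n) (∈-allFin x)
    where
    go : ∀ L → x ∈ₗ L → d v x ≤ eccOver S v L
    go (y ∷ L) (here refl) with y ∈? S
    ... | yes _  = m≤m⊔n _ _
    ... | no y∉S = ⊥-elim (y∉S x∈S)
    go (y ∷ L) (there x∈) with y ∈? S
    ... | yes _ = ≤-trans (go L x∈) (m≤n⊔m _ _)
    ... | no _  = go L x∈

  ecc-lub : ∀ {S m} → (∀ {x} → x ∈ S → d v x ≤ m) → ecc G S v ≤ m
  ecc-lub {v} {S} {m} bound = go (allFin n)
    where
    go : ∀ L → eccOver S v L ≤ m
    go []      = z≤n
    go (y ∷ L) with y ∈? S
    ... | yes y∈S = ⊔-lub (bound y∈S) (go L)
    ... | no _    = go L

  -- Geodesics in connected block graphs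

  module _ (connected : Connected G) where

    dist<n : d u v < n
    dist<n {u} {v} with walkIn⇒walk (connected u v ∈⊤ ∈⊤)
    ... | _ , p with shortcut p
    ...   | _ , p′ , uniq , _ = ≤-<-trans (dist-≤ (walk→reach p′)) (Unique⇒length≤ uniq)

    reach-dist : Reach (d u v) u v
    reach-dist = dist<n⇒reach-dist dist<n

    dist≡0⇒≡ : d u v ≡ 0 → u ≡ v
    dist≡0⇒≡ {u} {v} eq = reach-zero⇒≡ (subst (λ k → Reach k u v) eq reach-dist)

    dist-sym : ∀ u v → d u v ≡ d v u
    dist-sym u v = ≤-antisym (dist-≤ (reach-sym reach-dist)) (dist-≤ (reach-sym reach-dist))

    dist-snoc : Adj G w v → d u v ≤ suc (d u w)
    dist-snoc a = dist-≤ (reach-snoc reach-dist a)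

    dist-cons : Adj G u w → d u v ≤ suc (d w v)
    dist-cons {u} {w} {v} a = begin
      d u v       ≡⟨ dist-sym u v ⟩
      d v u       ≤⟨ dist-snoc (Adj-sym a) ⟩
      suc (d v w) ≡⟨ cong suc (dist-sym v w) ⟩
      suc (d w v) ∎
      where open ≤-Reasoning

    dist-pred : d u v ≡ suc k → ∃[ w ] Adj G w v × d u w ≡ k
    dist-pred {u} {v} {k} eq with reach-last (subst (λ j → Reach j u v) eq reach-dist)
    ... | inj₁ r = ⊥-elim (1+n≰n (subst (_≤ k) eq (dist-≤ r)))
    ... | inj₂ (w , r , a) = w , a , ≤-antisym (dist-≤ r) (≤-pred (subst (_≤ suc (d u w)) eq (dist-snoc a)))

    shortest-walk : ∀ u v → ∃[ vs ] Walk u v vs × length vs ≤ d u v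
    shortest-walk u v = reach→walk reach-dist

    detour : Adj G y w → d u y ≡ k → d u w ≡ suc k → d w x ≡ suc (d v x) → d u x ≤ d v x →
             ∃[ vs ] Walk y v vs × Unique (y ∷ vs) × w ∉ₗ y ∷ vs
    detour {y} {w} {u} {k} {x} {v} yw uy uw wx ux
      with shortest-walk y u | shortest-walk u x | shortest-walk x v
    ... | vs₁ , p₁ , len₁ | vs₂ , p₂ , len₂ | vs₃ , p₃ , len₃
      with shortcut (walk-++ p₁ (walk-++ p₂ p₃))
    ... | vs , p , uniq , vs⊆ =
      vs , p , uniq , λ { (here w≡y) → w∉ (here w≡y) ; (there w∈) → w∉ (there (vs⊆ w∈)) }
      where
      open ≤-Reasoning

      w∉₁ : w ∉ₗ y ∷ vs₁
      w∉₁ = ∉-walk-to p₁ (begin-strict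
        length vs₁ ≤⟨ len₁ ⟩
        d y u      ≡⟨ trans (dist-sym y u) uy ⟩
        k          <⟨ ≤-refl ⟩
        suc k      ≡⟨ trans (sym uw) (dist-sym u w) ⟩
        d w u      ∎)

      w∉₂ : w ∉ₗ u ∷ vs₂
      w∉₂ = ∉-walk-to p₂ (begin-strict
        length vs₂  ≤⟨ ≤-trans len₂ ux ⟩
        d v x       <⟨ ≤-refl ⟩
        suc (d v x) ≡⟨ sym wx ⟩
        d w x       ∎)

      w∉₃ : w ∉ₗ x ∷ vs₃
      w∉₃ = ∉-walk-from p₃ (begin-strict
        length vs₃  ≤⟨ len₃ ⟩
        d x v       ≡⟨ dist-sym x v ⟩
        d v x       <⟨ ≤-refl ⟩
        suc (d v x) ≡⟨ trans (sym wx) (dist-sym w x) ⟩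
        d x w       ∎)

      w∉ : w ∉ₗ y ∷ vs₁ ++ vs₂ ++ vs₃
      w∉ = ∉-∷-++ w∉₁ (∉-∷-++ w∉₂ w∉₃)

    module _ (blockGraph : IsBlockGraph G) where

      geodesic-pred-not-farther : Adj G w v → d u w ≡ suc k → d u v ≡ suc (suc k) →
                                  d w x ≡ suc (d v x) → ¬ d u x ≤ d v x
      geodesic-pred-not-farther {w} {v} {u} {k} wv uw uv wx ux with dist-pred uw
      ... | y , yw , uy with detour yw uy uw wx ux
      ... | vs , p , uniq , w∉ = 1+n≰n (begin
        suc (suc k) ≡⟨ sym uv ⟩
        d u v       ≤⟨ dist-snoc yv ⟩
        suc (d u y) ≡⟨ cong suc uy ⟩
        suc k       ∎)
        where
        open ≤-Reasoning

        y≢v : y ≢ v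
        y≢v refl = 1+n≰n (≤-trans (m≤n⇒m≤1+n ≤-refl) (≤-reflexive (trans (sym uv) uy)))

        yv : Adj G y v
        yv = blockGraph⇒noCutVertex-complete blockGraph
               (cycle-noCutVertex (Adj-sym yw ∷ p) (¬Any⇒All¬ _ w∉ ∷ uniq) (Adj-sym wv))
               y v (∈-vertexSet⁺ (there (here refl))) (∈-vertexSet⁺ (walk-end (Adj-sym yw ∷ p))) y≢v

      geodesic-pred-dist-≤ : Adj G w v → d u w ≡ suc k → d u v ≡ suc (suc k) → ∀ x → d w x ≤ d u x ⊔ d v x
      geodesic-pred-dist-≤ {w} {v} {u} wv uw uv x with d w x ≤? d v x
      ... | yes wx≤vx = ≤-trans wx≤vx (m≤n⊔m _ _)
      ... | no wx≰vx with d w x ≤? d u x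
      ...   | yes wx≤ux = ≤-trans wx≤ux (m≤m⊔n _ _)
      ...   | no wx≰ux = ⊥-elim (geodesic-pred-not-farther wv uw uv wx≡ ux≤vx)
        where
        wx≡ : d w x ≡ suc (d v x)
        wx≡ = ≤-antisym (dist-cons wv) (≰⇒> wx≰vx)

        ux≤vx : d u x ≤ d v x
        ux≤vx = ≤-pred (subst (d u x <_) wx≡ (≰⇒> wx≰ux))

      geodesic-pred-inCenter : ∀ {S} → InCenter G S u → InCenter G S v →
                               Adj G w v → d u w ≡ suc k → d u v ≡ suc (suc k) → InCenter G S w
      geodesic-pred-inCenter {u} {v} {w} {S = S} u∈ v∈ wv uw uv z = ≤-trans (ecc-lub bound) (v∈ z)
        where
        open ≤-Reasoning

        bound : x ∈ S → d w x ≤ ecc G S v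
        bound {x} x∈S = begin
          d w x                   ≤⟨ geodesic-pred-dist-≤ wv uw uv x ⟩
          d u x ⊔ d v x           ≤⟨ ⊔-mono-≤ (dist≤ecc x∈S) (dist≤ecc x∈S) ⟩
          ecc G S u ⊔ ecc G S v   ≡⟨ m≤n⇒m⊔n≡n (u∈ v) ⟩
          ecc G S v               ∎

      centerSet-connected : ∀ A S → (∀ v → (v ∈ A → InCenter G S v) × (InCenter G S v → v ∈ A)) →
                            InducedConnected G A
      centerSet-connected A S center u v u∈ v∈ = go (d u v) refl v∈
        where
        pred∈A : ∀ {t} → d u t ≡ suc k → Adj G w t → d u w ≡ k → t ∈ A → w ∈ A
        pred∈A {k = zero} _ _ uw _ with dist≡0⇒≡ uw
        ... | refl = u∈
        pred∈A {k = suc k} ut wt uw t∈ =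
          proj₂ (center _) (geodesic-pred-inCenter (proj₁ (center _) u∈) (proj₁ (center _) t∈) wt uw ut)

        go : ∀ k {t} → d u t ≡ k → t ∈ A → WalkIn G A u t
        go zero ut _ with dist≡0⇒≡ ut
        ... | refl = here u∈
        go (suc k) ut t∈ with dist-pred ut
        ... | w , wt , uw = walkIn-snoc (go k uw (pred∈A ut wt uw t∈)) wt t∈

mainTheorem5 : (n : ℕ) (G : Graph n) → Connected G → IsBlockGraph G →
               (A : Subset n) → IsCenterSet G A → InducedConnected G A
mainTheorem5 n G connected blockGraph A (S , _ , center) =
  centerSet-connected G connected blockGraph A S center
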